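{- Let $\Lambda$ be a ring with identity, $A,B,C\in\Lambda$, and $G=G(w)$. Then $G-1-(BG)z-(CGAG)z^2=0$ in $\Lambda[[z]]$.
   Context: A walk of length $l\ge0$ is an $(l+1)$-tuple $\alpha=(\alpha_0,\dots,\alpha_l)$ of integers with each $\alpha_i-\alpha_{i-1}\in\{ -1,0,1\}$; it is a walk from $\alpha_0$ to $\alpha_l$. Its weight is $w(\alpha)=1$ if $l=0$, and otherwise $w(\alpha)=U_1\cdots U_l$ with $U_i=A,B,C$ according as $\alpha_i-\alpha_{i-1}=-1,0,1$. A walk is standard if $\alpha_i\ge\alpha_l$ for all $i$. $G(w)=\sum w(\alpha)z^{l(\alpha)}$ over all standard walks from $0$ to $0$. -}

module Defs where

open import Level using (Level)
open import Data.Nat using (ℕ; zero; suc; _∸_)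
open import Data.Integer as ℤ using (ℤ; 0ℤ; 1ℤ; -1ℤ)
open import Data.List using (List; []; _∷_; map; concatMap; upTo; foldr; filter; last)
open import Data.List.Relation.Unary.All using (All; all?)
open import Data.Maybe using (Maybe; just; nothing)
open import Data.Product using (_×_)
open import Relation.Nullary using (Dec)
open import Relation.Nullary.Decidable using (_×-dec_)
open import Relation.Binary.PropositionalEquality using (_≡_)
open import Algebra.Bundles using (Ring)

data Step : Set where
  down flat up : Step

stepℤ : Step → ℤ
stepℤ down = -1ℤ
stepℤ flat = 0ℤ
stepℤ up   = 1ℤ

stepSeqs : ℕ → List (List Step)
stepSeqs zero    = [] ∷ []
stepSeqs (suc l) = concatMap (λ s → map (s ∷_) (stepSeqs l)) (down ∷ flat ∷ up ∷ [])

positionsFrom : ℤ → List Step → List ℤ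
positionsFrom a []       = a ∷ []
positionsFrom a (s ∷ ss) = a ∷ positionsFrom (a ℤ.+ stepℤ s) ss

endpoint : ℤ → List Step → ℤ
endpoint a []       = a
endpoint a (s ∷ ss) = endpoint (a ℤ.+ stepℤ s) ss

StdWalk00 : List Step → Set
StdWalk00 ss = All (λ a → endpoint 0ℤ ss ℤ.≤ a) (positionsFrom 0ℤ ss) × (endpoint 0ℤ ss ≡ 0ℤ)

stdWalk00? : (ss : List Step) → Dec (StdWalk00 ss)
stdWalk00? ss = all? (λ a → endpoint 0ℤ ss ℤ.≤? a) (positionsFrom 0ℤ ss) ×-dec (endpoint 0ℤ ss ℤ.≟ 0ℤ)

module PowerSeries {c ℓ : Level} (R : Ring c ℓ) where
  open Ring R

  Series : Set c
  Series = ℕ → Carrier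

  sumL : List Carrier → Carrier
  sumL = foldr _+_ 0#

  const : Carrier → Series
  const a zero    = a
  const a (suc n) = 0#

  Z : Series
  Z zero          = 0#
  Z (suc zero)    = 1#
  Z (suc (suc n)) = 0#

  _⊕_ : Series → Series → Series
  (f ⊕ g) n = f n + g n

  _⊖_ : Series → Series → Series
  (f ⊖ g) n = f n - g n

  _⊛_ : Series → Series → Series
  (f ⊛ g) n = sumL (map (λ k → f k * g (n ∸ k)) (upTo (suc n)))

  infixl 6 _⊕_ _⊖_
  infixl 7 _⊛_

  weight : Carrier → Carrier → Carrier → List Step → Carrier
  weight A B C []          = 1#
  weight A B C (down ∷ ss) = A * weight A B C ss
  weight A B C (flat ∷ ss) = B * weight A B C ss
  weight A B C (up   ∷ ss) = C * weight A B C ss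

  G : Carrier → Carrier → Carrier → Series
  G A B C l = sumL (map (weight A B C) (filter stdWalk00? (stepSeqs l)))

-- Let W_h be the series of walks that start at height h, never go below 0 and end at 0, so that
-- G = W_0.  Removing the first step gives
--   W_0 = 1 + z (B W_0 + C W_1)   and   W_(h+1) = z (A W_h + B W_(h+1) + C W_(h+2)).
-- Cutting a walk from h+1 at its first visit to h suggests the first-passage identity
-- W_(h+1) = z (G A) W_h.  It follows from the recurrences alone, coefficientwise by strong
-- induction on the length: the step needs W_(h+2) = z² (G A)(G A) W_h = z (W_1 A) W_h, which is
-- associativity of the Cauchy product.  Substituting W_1 = z G A G into the equation for W_0
-- gives G = 1 + z B G + z² C G A G.
module Submission where

open import Defs
open import Data.Nat using (ℕ; zero; suc; _∸_; _≤_; _<_; z≤n; s≤s)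
open import Data.Nat.Properties as ℕ using (≤-refl; ≤-trans; <⇒≤; m≤n⇒m≤1+n)
open import Data.Nat.Induction using (<-rec)
open import Data.Integer as ℤ using (ℤ; 0ℤ; -1ℤ; +_)
open import Data.Integer.Properties as ℤ using ()
open import Data.Bool using (Bool; true; false; T)
open import Data.Unit using (tt)
open import Data.List using (List; []; _∷_; map; _++_; filterᵇ)
open import Data.List.Properties using (map-∘; map-cong; map-++; map-applyUpTo; filter-++; filter-≐; ++-identityʳ)
open import Data.List.Relation.Unary.All using (All; []; _∷_)
open import Data.Product using (_×_; _,_; map₁)
open import Relation.Nullary using (contradiction)
open import Relation.Nullary.Decidable using (T?)
open import Relation.Unary using (_≐_)
open import Function using (_∘_; id)
open import Relation.Binary.PropositionalEquality as ≡ using (_≡_; cong; subst)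
open import Algebra.Bundles using (Ring)

filterᵇ-map : ∀ {a b} {X : Set a} {Y : Set b} (p : Y → Bool) (f : X → Y) xs →
              filterᵇ p (map f xs) ≡ map f (filterᵇ (p ∘ f) xs)
filterᵇ-map p f []       = ≡.refl
filterᵇ-map p f (x ∷ xs) with p (f x)
... | true  = ≡.cong (f x ∷_) (filterᵇ-map p f xs)
... | false = filterᵇ-map p f xs

-- returns h ss: the walk with steps ss started at height h never goes below 0 and ends at 0.
-- The step is matched first so that flat and up steps compute for a variable height.
returns : ℕ → List Step → Bool
returns h       (flat ∷ ss) = returns h ss
returns h       (up   ∷ ss) = returns (suc h) ss
returns zero    (down ∷ ss) = false
returns (suc h) (down ∷ ss) = returns h ss
returns zero    []          = true
returns (suc h) []          = false

All-positionsFrom-start : ∀ {P : ℤ → Set} a ss → All P (positionsFrom a ss) → P a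
All-positionsFrom-start a []      (pa ∷ _) = pa
All-positionsFrom-start a (_ ∷ _) (pa ∷ _) = pa

returns-complete : ∀ {a} h ss → a ≡ + h →
  All (endpoint a ss ℤ.≤_) (positionsFrom a ss) → endpoint a ss ≡ 0ℤ → T (returns h ss)
returns-complete zero    []          _      _          _  = tt
returns-complete (suc h) []          ≡.refl _          ()
returns-complete zero    (down ∷ ss) ≡.refl (_ ∷ above) end≡0 =
  contradiction (subst (ℤ._≤ -1ℤ) end≡0 (All-positionsFrom-start _ ss above)) λ ()
returns-complete (suc h) (down ∷ ss) ≡.refl (_ ∷ above) end≡0 =
  returns-complete h ss ≡.refl above end≡0
returns-complete h (flat ∷ ss) a≡h (_ ∷ above) end≡0 =
  returns-complete h ss (≡.trans (cong (ℤ._+ 0ℤ) a≡h) (ℤ.+-identityʳ (+ h))) above end≡0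
returns-complete h (up ∷ ss) a≡h (_ ∷ above) end≡0 =
  returns-complete (suc h) ss (≡.trans (cong (ℤ._+ + 1) a≡h) (cong +_ (ℕ.+-comm h 1))) above end≡0

returns-sound : ∀ {a} h ss → a ≡ + h → T (returns h ss) →
  All (0ℤ ℤ.≤_) (positionsFrom a ss) × endpoint a ss ≡ 0ℤ
returns-sound zero    []          ≡.refl _ = ℤ.+≤+ z≤n ∷ [] , ≡.refl
returns-sound (suc h) (down ∷ ss) ≡.refl r =
  map₁ (ℤ.+≤+ z≤n ∷_) (returns-sound h ss ≡.refl r)
returns-sound h       (flat ∷ ss) ≡.refl r =
  map₁ (ℤ.+≤+ z≤n ∷_) (returns-sound h ss (ℤ.+-identityʳ (+ h)) r)
returns-sound h       (up   ∷ ss) ≡.refl r =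
  map₁ (ℤ.+≤+ z≤n ∷_) (returns-sound (suc h) ss (cong +_ (ℕ.+-comm h 1)) r)

stdWalk00≐returns₀ : StdWalk00 ≐ (T ∘ returns 0)
stdWalk00≐returns₀ = (λ (above , end≡0) → returns-complete 0 _ ≡.refl above end≡0)
                   , λ {ss} r → let above , end≡0 = returns-sound 0 ss ≡.refl r
                                in subst (λ e → All (e ℤ.≤_) (positionsFrom 0ℤ ss)) (≡.sym end≡0) above , end≡0

module RingLemmas {c ℓ} (R : Ring c ℓ) where
  open Ring R
  open import Algebra.Properties.Group +-group using (//-rightDividesʳ; x≈y⇒x∙y⁻¹≈ε)

  x≈y+z⇒x-y≈z : ∀ {x y z} → x ≈ y + z → x - y ≈ z
  x≈y+z⇒x-y≈z {y = y} {z} x≈y+z = trans (+-congʳ (trans x≈y+z (+-comm y z))) (//-rightDividesʳ y z)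

  x≈a+b+c⇒x-a-b-c≈0 : ∀ {x a b c} → x ≈ a + b + c → x - a - b - c ≈ 0#
  x≈a+b+c⇒x-a-b-c≈0 {a = a} {b} {c} eq =
    x≈y⇒x∙y⁻¹≈ε (x≈y+z⇒x-y≈z (x≈y+z⇒x-y≈z (trans eq (+-assoc a b c))))

module SeriesAlgebra {c ℓ} (R : Ring c ℓ) where
  open Ring R
  open PowerSeries R
  open import Relation.Binary.Reasoning.Setoid setoid
  open import Algebra.Properties.CommutativeSemigroup +-commutativeSemigroup
    using () renaming (interchange to +-interchange)

  sumL-++ : ∀ xs ys → sumL (xs ++ ys) ≈ sumL xs + sumL ys
  sumL-++ []       ys = sym (+-identityˡ _)
  sumL-++ (x ∷ xs) ys = trans (+-congˡ (sumL-++ xs ys)) (sym (+-assoc _ _ _))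

  sumL-*ˡ : ∀ a xs → sumL (map (a *_) xs) ≈ a * sumL xs
  sumL-*ˡ a []       = sym (zeroʳ a)
  sumL-*ˡ a (x ∷ xs) = trans (+-congˡ (sumL-*ˡ a xs)) (sym (distribˡ a x _))

  infix 4 _≋_
  _≋_ : Series → Series → Set ℓ
  f ≋ g = ∀ n → f n ≈ g n

  infixl 7 _*ₗ_ _*ᵣ_

  _*ₗ_ : Carrier → Series → Series
  (a *ₗ f) n = a * f n

  _*ᵣ_ : Series → Carrier → Series
  (f *ᵣ a) n = f n * a

  shift : Series → Series
  shift f zero    = 0#
  shift f (suc n) = f n

  shift-cong< : ∀ {f g} n → (∀ k → suc k ≤ n → f k ≈ g k) → shift f n ≈ shift g n
  shift-cong< zero    f≈g = refl
  shift-cong< (suc n) f≈g = f≈g n ≤-refl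

  shift-cong : ∀ {f g} → f ≋ g → shift f ≋ shift g
  shift-cong f≈g n = shift-cong< n (λ k _ → f≈g k)

  shift-⊕ : ∀ f g → shift (f ⊕ g) ≋ shift f ⊕ shift g
  shift-⊕ f g zero    = sym (+-identityˡ 0#)
  shift-⊕ f g (suc n) = refl

  shift-*ₗ : ∀ a f → shift (a *ₗ f) ≋ a *ₗ shift f
  shift-*ₗ a f zero    = sym (zeroʳ a)
  shift-*ₗ a f (suc n) = refl

  shift-*ᵣ : ∀ f a → shift (f *ᵣ a) ≋ shift f *ᵣ a
  shift-*ᵣ f a zero    = sym (zeroˡ a)
  shift-*ᵣ f a (suc n) = refl

  ⊛-zero : ∀ f g → (f ⊛ g) 0 ≈ f 0 * g 0
  ⊛-zero f g = +-identityʳ _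

  ⊛-suc : ∀ f g n → (f ⊛ g) (suc n) ≈ f 0 * g (suc n) + ((f ∘ suc) ⊛ g) n
  ⊛-suc f g n = reflexive (≡.cong (λ xs → f 0 * g (suc n) + sumL xs)
    (≡.trans (map-applyUpTo suc (λ k → f k * g (suc n ∸ k)) (suc n))
             (≡.sym (map-applyUpTo id (λ k → f (suc k) * g (n ∸ k)) (suc n)))))

  ⊛-unfold : ∀ f g → f ⊛ g ≋ f 0 *ₗ g ⊕ shift ((f ∘ suc) ⊛ g)
  ⊛-unfold f g zero    = refl
  ⊛-unfold f g (suc n) = ⊛-suc f g n

  ⊛-cong≤ : ∀ {f f′ g g′} n → (∀ k → k ≤ n → f k ≈ f′ k) → (∀ k → k ≤ n → g k ≈ g′ k) →
            (f ⊛ g) n ≈ (f′ ⊛ g′) n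
  ⊛-cong≤ zero f≈ g≈ = +-congʳ (*-cong (f≈ 0 ≤-refl) (g≈ 0 ≤-refl))
  ⊛-cong≤ {f} {f′} {g} {g′} (suc n) f≈ g≈ = begin
    (f ⊛ g) (suc n)                        ≈⟨ ⊛-suc f g n ⟩
    f 0 * g (suc n) + ((f ∘ suc) ⊛ g) n    ≈⟨ +-cong (*-cong (f≈ 0 z≤n) (g≈ (suc n) ≤-refl))
                                                      (⊛-cong≤ n (λ k k≤n → f≈ (suc k) (s≤s k≤n))
                                                                 (λ k k≤n → g≈ k (m≤n⇒m≤1+n k≤n))) ⟩
    f′ 0 * g′ (suc n) + ((f′ ∘ suc) ⊛ g′) n ≈⟨ ⊛-suc f′ g′ n ⟨
    (f′ ⊛ g′) (suc n)                      ∎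

  ⊛-cong : ∀ {f f′ g g′} → f ≋ f′ → g ≋ g′ → f ⊛ g ≋ f′ ⊛ g′
  ⊛-cong f≈ g≈ n = ⊛-cong≤ n (λ k _ → f≈ k) (λ k _ → g≈ k)

  0-⊛ : ∀ g → (λ _ → 0#) ⊛ g ≋ λ _ → 0#
  0-⊛ g zero    = trans (+-identityʳ _) (zeroˡ (g 0))
  0-⊛ g (suc n) = begin
    ((λ _ → 0#) ⊛ g) (suc n)            ≈⟨ ⊛-suc _ g n ⟩
    0# * g (suc n) + ((λ _ → 0#) ⊛ g) n  ≈⟨ +-cong (zeroˡ _) (0-⊛ g n) ⟩
    0# + 0#                             ≈⟨ +-identityʳ 0# ⟩
    0#                                  ∎

  ⊛-distribʳ : ∀ f g h → (f ⊕ g) ⊛ h ≋ f ⊛ h ⊕ g ⊛ h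
  ⊛-distribʳ f g h zero    = trans (+-identityʳ _) (trans (distribʳ (h 0) (f 0) (g 0))
                               (sym (+-cong (+-identityʳ _) (+-identityʳ _))))
  ⊛-distribʳ f g h (suc n) = begin
    ((f ⊕ g) ⊛ h) (suc n)
      ≈⟨ ⊛-suc (f ⊕ g) h n ⟩
    (f 0 + g 0) * h (suc n) + ((f ∘ suc ⊕ g ∘ suc) ⊛ h) n
      ≈⟨ +-cong (distribʳ (h (suc n)) (f 0) (g 0)) (⊛-distribʳ (f ∘ suc) (g ∘ suc) h n) ⟩
    (f 0 * h (suc n) + g 0 * h (suc n)) + (((f ∘ suc) ⊛ h) n + ((g ∘ suc) ⊛ h) n)
      ≈⟨ +-interchange _ _ _ _ ⟩
    (f 0 * h (suc n) + ((f ∘ suc) ⊛ h) n) + (g 0 * h (suc n) + ((g ∘ suc) ⊛ h) n)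
      ≈⟨ +-cong (⊛-suc f h n) (⊛-suc g h n) ⟨
    (f ⊛ h) (suc n) + (g ⊛ h) (suc n)
      ∎

  *ₗ-⊛ : ∀ a f g → (a *ₗ f) ⊛ g ≋ a *ₗ (f ⊛ g)
  *ₗ-⊛ a f g zero    = begin
    ((a *ₗ f) ⊛ g) 0  ≈⟨ ⊛-zero (a *ₗ f) g ⟩
    a * f 0 * g 0     ≈⟨ *-assoc a (f 0) (g 0) ⟩
    a * (f 0 * g 0)   ≈⟨ *-congˡ (⊛-zero f g) ⟨
    a * (f ⊛ g) 0     ∎
  *ₗ-⊛ a f g (suc n) = begin
    ((a *ₗ f) ⊛ g) (suc n)
      ≈⟨ ⊛-suc (a *ₗ f) g n ⟩
    a * f 0 * g (suc n) + ((a *ₗ (f ∘ suc)) ⊛ g) n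
      ≈⟨ +-cong (*-assoc a (f 0) (g (suc n))) (*ₗ-⊛ a (f ∘ suc) g n) ⟩
    a * (f 0 * g (suc n)) + a * ((f ∘ suc) ⊛ g) n
      ≈⟨ distribˡ a _ _ ⟨
    a * (f 0 * g (suc n) + ((f ∘ suc) ⊛ g) n)
      ≈⟨ *-congˡ (⊛-suc f g n) ⟨
    a * (f ⊛ g) (suc n)
      ∎

  ⊛-*ᵣ : ∀ f g a → (f ⊛ g) *ᵣ a ≋ f ⊛ (g *ᵣ a)
  ⊛-*ᵣ f g a zero    = begin
    (f ⊛ g) 0 * a          ≈⟨ *-congʳ (⊛-zero f g) ⟩
    f 0 * g 0 * a          ≈⟨ *-assoc (f 0) (g 0) a ⟩
    f 0 * (g 0 * a)        ≈⟨ ⊛-zero f (g *ᵣ a) ⟨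
    (f ⊛ (g *ᵣ a)) 0       ∎
  ⊛-*ᵣ f g a (suc n) = begin
    (f ⊛ g) (suc n) * a
      ≈⟨ *-congʳ (⊛-suc f g n) ⟩
    (f 0 * g (suc n) + ((f ∘ suc) ⊛ g) n) * a
      ≈⟨ distribʳ a _ _ ⟩
    f 0 * g (suc n) * a + ((f ∘ suc) ⊛ g) n * a
      ≈⟨ +-cong (*-assoc (f 0) (g (suc n)) a) (⊛-*ᵣ (f ∘ suc) g a n) ⟩
    f 0 * (g (suc n) * a) + ((f ∘ suc) ⊛ (g *ᵣ a)) n
      ≈⟨ ⊛-suc f (g *ᵣ a) n ⟨
    (f ⊛ (g *ᵣ a)) (suc n)
      ∎

  ⊛-assoc : ∀ f g h → (f ⊛ g) ⊛ h ≋ f ⊛ (g ⊛ h)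
  ⊛-assoc f g h zero    = begin
    ((f ⊛ g) ⊛ h) 0      ≈⟨ ⊛-zero (f ⊛ g) h ⟩
    (f ⊛ g) 0 * h 0      ≈⟨ *-congʳ (⊛-zero f g) ⟩
    f 0 * g 0 * h 0      ≈⟨ *-assoc (f 0) (g 0) (h 0) ⟩
    f 0 * (g 0 * h 0)    ≈⟨ *-congˡ (⊛-zero g h) ⟨
    f 0 * (g ⊛ h) 0      ≈⟨ ⊛-zero f (g ⊛ h) ⟨
    (f ⊛ (g ⊛ h)) 0      ∎
  ⊛-assoc f g h (suc n) = begin
    ((f ⊛ g) ⊛ h) (suc n)
      ≈⟨ ⊛-suc (f ⊛ g) h n ⟩
    (f ⊛ g) 0 * h (suc n) + (((f ⊛ g) ∘ suc) ⊛ h) n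
      ≈⟨ +-cong (*-congʳ (⊛-zero f g)) (⊛-cong {g = h} (⊛-suc f g) (λ _ → refl) n) ⟩
    f 0 * g 0 * h (suc n) + ((f 0 *ₗ (g ∘ suc) ⊕ (f ∘ suc) ⊛ g) ⊛ h) n
      ≈⟨ +-congˡ (⊛-distribʳ _ _ h n) ⟩
    f 0 * g 0 * h (suc n) + (((f 0 *ₗ (g ∘ suc)) ⊛ h) n + (((f ∘ suc) ⊛ g) ⊛ h) n)
      ≈⟨ +-cong (*-assoc (f 0) (g 0) (h (suc n)))
                (+-cong (*ₗ-⊛ (f 0) (g ∘ suc) h n) (⊛-assoc (f ∘ suc) g h n)) ⟩
    f 0 * (g 0 * h (suc n)) + (f 0 * ((g ∘ suc) ⊛ h) n + ((f ∘ suc) ⊛ (g ⊛ h)) n)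
      ≈⟨ +-assoc _ _ _ ⟨
    f 0 * (g 0 * h (suc n)) + f 0 * ((g ∘ suc) ⊛ h) n + ((f ∘ suc) ⊛ (g ⊛ h)) n
      ≈⟨ +-congʳ (distribˡ (f 0) _ _) ⟨
    f 0 * (g 0 * h (suc n) + ((g ∘ suc) ⊛ h) n) + ((f ∘ suc) ⊛ (g ⊛ h)) n
      ≈⟨ +-congʳ (*-congˡ (⊛-suc g h n)) ⟨
    f 0 * (g ⊛ h) (suc n) + ((f ∘ suc) ⊛ (g ⊛ h)) n
      ≈⟨ ⊛-suc f (g ⊛ h) n ⟨
    (f ⊛ (g ⊛ h)) (suc n)
      ∎

  ⊛-shiftˡ : ∀ f g → shift f ⊛ g ≋ shift (f ⊛ g)
  ⊛-shiftˡ f g zero    = trans (+-identityʳ _) (zeroˡ (g 0))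
  ⊛-shiftˡ f g (suc n) = trans (⊛-suc (shift f) g n) (trans (+-congʳ (zeroˡ _)) (+-identityˡ _))

  ⊛-shiftʳ : ∀ f g → f ⊛ shift g ≋ shift (f ⊛ g)
  ⊛-shiftʳ f g zero    = trans (+-identityʳ _) (zeroʳ (f 0))
  ⊛-shiftʳ f g (suc n) = begin
    (f ⊛ shift g) (suc n)                   ≈⟨ ⊛-suc f (shift g) n ⟩
    f 0 * g n + ((f ∘ suc) ⊛ shift g) n      ≈⟨ +-congˡ (⊛-shiftʳ (f ∘ suc) g n) ⟩
    f 0 * g n + shift ((f ∘ suc) ⊛ g) n      ≈⟨ ⊛-unfold f g n ⟨
    (f ⊛ g) n                               ∎

  const-⊛ : ∀ a f → const a ⊛ f ≋ a *ₗ f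
  const-⊛ a f zero    = ⊛-zero (const a) f
  const-⊛ a f (suc n) = trans (⊛-suc (const a) f n) (trans (+-congˡ (0-⊛ f n)) (+-identityʳ _))

  ⊛-const : ∀ f a → f ⊛ const a ≋ f *ᵣ a
  ⊛-const f a zero    = ⊛-zero f (const a)
  ⊛-const f a (suc n) = trans (⊛-suc f (const a) n) (trans (+-cong (zeroʳ (f 0)) (⊛-const (f ∘ suc) a n)) (+-identityˡ _))

  Z≋shift-1 : Z ≋ shift (const 1#)
  Z≋shift-1 zero          = refl
  Z≋shift-1 (suc zero)    = refl
  Z≋shift-1 (suc (suc n)) = refl

  ⊛-Z : ∀ f → f ⊛ Z ≋ shift f
  ⊛-Z f n = begin
    (f ⊛ Z) n                 ≈⟨ ⊛-cong (λ _ → refl) Z≋shift-1 n ⟩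
    (f ⊛ shift (const 1#)) n  ≈⟨ ⊛-shiftʳ f (const 1#) n ⟩
    shift (f ⊛ const 1#) n    ≈⟨ shift-cong (λ k → trans (⊛-const f 1# k) (*-identityʳ (f k))) n ⟩
    shift f n                 ∎

  const-⊛-const-⊛ : ∀ a f b g → const a ⊛ f ⊛ const b ⊛ g ≋ a *ₗ ((f *ᵣ b) ⊛ g)
  const-⊛-const-⊛ a f b g n = begin
    ((const a ⊛ f ⊛ const b) ⊛ g) n  ≈⟨ ⊛-cong {g = g} afb≋ (λ _ → refl) n ⟩
    ((a *ₗ (f *ᵣ b)) ⊛ g) n          ≈⟨ *ₗ-⊛ a (f *ᵣ b) g n ⟩
    a * ((f *ᵣ b) ⊛ g) n             ∎
    where
    afb≋ : const a ⊛ f ⊛ const b ≋ a *ₗ (f *ᵣ b)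
    afb≋ k = trans (⊛-const _ b k) (trans (*-congʳ (const-⊛ a f k)) (*-assoc a (f k) b))

module Returning {c ℓ} (R : Ring c ℓ) (A B C : Ring.Carrier R) where
  open Ring R
  open PowerSeries R
  open SeriesAlgebra R
  open import Relation.Binary.Reasoning.Setoid setoid

  letter : Step → Carrier
  letter down = A
  letter flat = B
  letter up   = C

  weight-∷ : ∀ s ss → weight A B C (s ∷ ss) ≡ letter s * weight A B C ss
  weight-∷ down ss = ≡.refl
  weight-∷ flat ss = ≡.refl
  weight-∷ up   ss = ≡.refl

  filteredWeight : (List Step → Bool) → List (List Step) → Carrier
  filteredWeight p xs = sumL (map (weight A B C) (filterᵇ p xs))

  filteredWeight-++ : ∀ p xs ys → filteredWeight p (xs ++ ys) ≈ filteredWeight p xs + filteredWeight p ys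
  filteredWeight-++ p xs ys = begin
    sumL (map (weight A B C) (filterᵇ p (xs ++ ys)))
      ≡⟨ ≡.cong (sumL ∘ map (weight A B C)) (filter-++ (T? ∘ p) xs ys) ⟩
    sumL (map (weight A B C) (filterᵇ p xs ++ filterᵇ p ys))
      ≡⟨ ≡.cong sumL (map-++ (weight A B C) (filterᵇ p xs) _) ⟩
    sumL (map (weight A B C) (filterᵇ p xs) ++ map (weight A B C) (filterᵇ p ys))
      ≈⟨ sumL-++ (map (weight A B C) (filterᵇ p xs)) _ ⟩
    filteredWeight p xs + filteredWeight p ys
      ∎

  filteredWeight-∷ : ∀ p s xs → filteredWeight p (map (s ∷_) xs) ≈ letter s * filteredWeight (p ∘ (s ∷_)) xs
  filteredWeight-∷ p s xs = begin
    sumL (map (weight A B C) (filterᵇ p (map (s ∷_) xs)))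
      ≡⟨ ≡.cong (sumL ∘ map (weight A B C)) (filterᵇ-map p (s ∷_) xs) ⟩
    sumL (map (weight A B C) (map (s ∷_) ys))
      ≡⟨ ≡.cong sumL (≡.trans (≡.sym (map-∘ ys)) (≡.trans (map-cong (weight-∷ s) ys) (map-∘ ys))) ⟩
    sumL (map (letter s *_) (map (weight A B C) ys))
      ≈⟨ sumL-*ˡ (letter s) (map (weight A B C) ys) ⟩
    letter s * filteredWeight (p ∘ (s ∷_)) xs
      ∎
    where ys = filterᵇ (p ∘ (s ∷_)) xs

  filteredWeight-none : ∀ xs → filteredWeight (λ _ → false) xs ≈ 0#
  filteredWeight-none []       = refl
  filteredWeight-none (x ∷ xs) = filteredWeight-none xs

  weightSum : (List Step → Bool) → Series
  weightSum p l = filteredWeight p (stepSeqs l)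

  weightSum-suc : ∀ p l → weightSum p (suc l) ≈
    A * weightSum (p ∘ (down ∷_)) l + (B * weightSum (p ∘ (flat ∷_)) l + C * weightSum (p ∘ (up ∷_)) l)
  weightSum-suc p l = begin
    filteredWeight p (map (down ∷_) L ++ (map (flat ∷_) L ++ (map (up ∷_) L ++ [])))
      ≈⟨ filteredWeight-++ p (map (down ∷_) L) _ ⟩
    filteredWeight p (map (down ∷_) L) + filteredWeight p (map (flat ∷_) L ++ (map (up ∷_) L ++ []))
      ≈⟨ +-congˡ (filteredWeight-++ p (map (flat ∷_) L) _) ⟩
    filteredWeight p (map (down ∷_) L) + (filteredWeight p (map (flat ∷_) L) + filteredWeight p (map (up ∷_) L ++ []))
      ≡⟨ ≡.cong (λ ups → filteredWeight p (map (down ∷_) L) + (filteredWeight p (map (flat ∷_) L) + filteredWeight p ups))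
                (++-identityʳ (map (up ∷_) L)) ⟩
    filteredWeight p (map (down ∷_) L) + (filteredWeight p (map (flat ∷_) L) + filteredWeight p (map (up ∷_) L))
      ≈⟨ +-cong (filteredWeight-∷ p down L) (+-cong (filteredWeight-∷ p flat L) (filteredWeight-∷ p up L)) ⟩
    A * weightSum (p ∘ (down ∷_)) l + (B * weightSum (p ∘ (flat ∷_)) l + C * weightSum (p ∘ (up ∷_)) l)
      ∎
    where L = stepSeqs l

  returning : ℕ → Series
  returning h = weightSum (returns h)

  returning-zero-zero : returning 0 0 ≈ 1#
  returning-zero-zero = +-identityʳ 1#

  returning-zero-suc : ∀ l → returning 0 (suc l) ≈ B * returning 0 l + C * returning 1 l
  returning-zero-suc l = begin
    returning 0 (suc l)                                ≈⟨ weightSum-suc (returns 0) l ⟩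
    A * weightSum (λ _ → false) l + (B * returning 0 l + C * returning 1 l)
      ≈⟨ +-congʳ (trans (*-congˡ (filteredWeight-none (stepSeqs l))) (zeroʳ A)) ⟩
    0# + (B * returning 0 l + C * returning 1 l)       ≈⟨ +-identityˡ _ ⟩
    B * returning 0 l + C * returning 1 l              ∎

  returning-suc-suc : ∀ h l → returning (suc h) (suc l) ≈
    A * returning h l + (B * returning (suc h) l + C * returning (suc (suc h)) l)
  returning-suc-suc h = weightSum-suc (returns (suc h))

  G≋returning₀ : G A B C ≋ returning 0
  G≋returning₀ l = reflexive (≡.cong (sumL ∘ map (weight A B C))
    (filter-≐ stdWalk00? (T? ∘ returns 0) stdWalk00≐returns₀ (stepSeqs l)))

  returning·A : ℕ → Series
  returning·A h = returning h *ᵣ A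

  returning·A-zero-suc : returning·A 0 ∘ suc ≋ B *ₗ returning·A 0 ⊕ C *ₗ returning·A 1
  returning·A-zero-suc l = begin
    returning 0 (suc l) * A                             ≈⟨ *-congʳ (returning-zero-suc l) ⟩
    (B * returning 0 l + C * returning 1 l) * A         ≈⟨ distribʳ A _ _ ⟩
    B * returning 0 l * A + C * returning 1 l * A       ≈⟨ +-cong (*-assoc B _ A) (*-assoc C _ A) ⟩
    B * returning·A 0 l + C * returning·A 1 l           ∎

  returning·A-zero-suc-⊛ : ∀ f → (returning·A 0 ∘ suc) ⊛ f ≋
                                   B *ₗ (returning·A 0 ⊛ f) ⊕ C *ₗ (returning·A 1 ⊛ f)
  returning·A-zero-suc-⊛ f n = begin
    ((returning·A 0 ∘ suc) ⊛ f) n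
      ≈⟨ ⊛-cong {g = f} returning·A-zero-suc (λ _ → refl) n ⟩
    ((B *ₗ returning·A 0 ⊕ C *ₗ returning·A 1) ⊛ f) n
      ≈⟨ ⊛-distribʳ _ _ f n ⟩
    ((B *ₗ returning·A 0) ⊛ f) n + ((C *ₗ returning·A 1) ⊛ f) n
      ≈⟨ +-cong (*ₗ-⊛ B (returning·A 0) f n) (*ₗ-⊛ C (returning·A 1) f n) ⟩
    B * (returning·A 0 ⊛ f) n + C * (returning·A 1 ⊛ f) n
      ∎

  FirstPassage : ℕ → Set ℓ
  FirstPassage n = ∀ h → returning (suc h) n ≈ shift (returning·A 0 ⊛ returning h) n

  -- Two first passages in a row, regrouped by associativity.
  ⊛-returning-suc : ∀ n → (∀ k → k ≤ n → FirstPassage k) →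
                    ∀ h → (returning·A 0 ⊛ returning (suc h)) n ≈ (returning·A 1 ⊛ returning h) n
  ⊛-returning-suc n firstPassage≤n h = begin
    (gA ⊛ returning (suc h)) n        ≈⟨ ⊛-cong≤ {f = gA} n (λ _ _ → refl) (λ k k≤n → firstPassage≤n k k≤n h) ⟩
    (gA ⊛ shift (gA ⊛ returning h)) n ≈⟨ ⊛-shiftʳ gA _ n ⟩
    shift (gA ⊛ (gA ⊛ returning h)) n ≈⟨ shift-cong (λ k → ⊛-assoc gA gA (returning h) k) n ⟨
    shift ((gA ⊛ gA) ⊛ returning h) n ≈⟨ ⊛-shiftˡ (gA ⊛ gA) (returning h) n ⟨
    (shift (gA ⊛ gA) ⊛ returning h) n ≈⟨ ⊛-cong≤ {g = returning h} n returning·A-one (λ _ _ → refl) ⟨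
    (returning·A 1 ⊛ returning h) n   ∎
    where
    gA = returning·A 0
    returning·A-one : ∀ k → k ≤ n → returning·A 1 k ≈ shift (gA ⊛ gA) k
    returning·A-one k k≤n = begin
      returning 1 k * A                   ≈⟨ *-congʳ (firstPassage≤n k k≤n 0) ⟩
      shift (gA ⊛ returning 0) k * A      ≈⟨ shift-*ᵣ (gA ⊛ returning 0) A k ⟨
      shift ((gA ⊛ returning 0) *ᵣ A) k   ≈⟨ shift-cong (⊛-*ᵣ gA (returning 0) A) k ⟩
      shift (gA ⊛ gA) k                   ∎

  firstPassage : ∀ n → FirstPassage n
  firstPassage = <-rec FirstPassage step
    where
    gA = returning·A 0
    step : ∀ n → (∀ {k} → k < n → FirstPassage k) → FirstPassage n
    step zero    _  h = refl
    step (suc m) ih h = begin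
      returning (suc h) (suc m)
        ≈⟨ returning-suc-suc h m ⟩
      A * returning h m + (B * returning (suc h) m + C * returning (suc (suc h)) m)
        ≈⟨ +-cong (*-congʳ (sym gA₀≈A)) (+-cong (*-congˡ (ih ≤-refl h)) (*-congˡ (ih ≤-refl (suc h)))) ⟩
      gA 0 * returning h m + (B * shift (gA ⊛ returning h) m + C * shift (gA ⊛ returning (suc h)) m)
        ≈⟨ +-congˡ (+-congˡ (*-congˡ (shift-cong< m λ k k<m →
             ⊛-returning-suc k (λ j j≤k → ih (s≤s (≤-trans j≤k (<⇒≤ k<m)))) h))) ⟩
      gA 0 * returning h m + (B * shift (gA ⊛ returning h) m + C * shift (returning·A 1 ⊛ returning h) m)
        ≈⟨ +-congˡ (+-cong (shift-*ₗ B _ m) (shift-*ₗ C _ m)) ⟨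
      gA 0 * returning h m + (shift (B *ₗ (gA ⊛ returning h)) m + shift (C *ₗ (returning·A 1 ⊛ returning h)) m)
        ≈⟨ +-congˡ (shift-⊕ _ _ m) ⟨
      gA 0 * returning h m + shift (B *ₗ (gA ⊛ returning h) ⊕ C *ₗ (returning·A 1 ⊛ returning h)) m
        ≈⟨ +-congˡ (shift-cong (returning·A-zero-suc-⊛ (returning h)) m) ⟨
      gA 0 * returning h m + shift ((gA ∘ suc) ⊛ returning h) m
        ≈⟨ ⊛-unfold gA (returning h) m ⟨
      (gA ⊛ returning h) m
        ∎
      where
      gA₀≈A : gA 0 ≈ A
      gA₀≈A = trans (*-congʳ returning-zero-zero) (*-identityˡ A)

  returning₀-equation : returning 0 ≋ const 1# ⊕ shift (B *ₗ returning 0) ⊕ shift (shift (C *ₗ (returning·A 0 ⊛ returning 0)))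
  returning₀-equation zero    = trans returning-zero-zero (sym (trans (+-identityʳ _) (+-identityʳ 1#)))
  returning₀-equation (suc n) = begin
    returning 0 (suc n)                                      ≈⟨ returning-zero-suc n ⟩
    B * returning 0 n + C * returning 1 n                    ≈⟨ +-cong (sym (+-identityˡ _)) (*-congˡ (firstPassage n 0)) ⟩
    0# + B * returning 0 n + C * shift (returning·A 0 ⊛ returning 0) n
                                                             ≈⟨ +-congˡ (shift-*ₗ C _ n) ⟨
    0# + B * returning 0 n + shift (C *ₗ (returning·A 0 ⊛ returning 0)) n  ∎

  G-equation : G A B C ≋ const 1# ⊕ const B ⊛ G A B C ⊛ Z ⊕ const C ⊛ G A B C ⊛ const A ⊛ G A B C ⊛ Z ⊛ Z
  G-equation n = begin
    G A B C n          ≈⟨ G≋returning₀ n ⟩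
    returning 0 n      ≈⟨ returning₀-equation n ⟩
    (const 1# ⊕ shift (B *ₗ g) ⊕ shift (shift (C *ₗ (returning·A 0 ⊛ g)))) n
                       ≈⟨ +-cong (+-congˡ (B-term n)) (C-term n) ⟨
    (const 1# ⊕ const B ⊛ G A B C ⊛ Z ⊕ const C ⊛ G A B C ⊛ const A ⊛ G A B C ⊛ Z ⊛ Z) n  ∎
    where
    g = returning 0
    B-term : const B ⊛ G A B C ⊛ Z ≋ shift (B *ₗ g)
    B-term n = trans (⊛-Z _ n) (shift-cong (λ k → trans (const-⊛ B (G A B C) k) (*-congˡ (G≋returning₀ k))) n)
    C-term : const C ⊛ G A B C ⊛ const A ⊛ G A B C ⊛ Z ⊛ Z ≋ shift (shift (C *ₗ (returning·A 0 ⊛ g)))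
    C-term n = trans (⊛-Z _ n) (shift-cong (λ k → trans (⊛-Z _ k) (shift-cong CGAG≋ k)) n)
      where
      CGAG≋ : const C ⊛ G A B C ⊛ const A ⊛ G A B C ≋ C *ₗ (returning·A 0 ⊛ g)
      CGAG≋ j = trans (const-⊛-const-⊛ C (G A B C) A (G A B C) j)
                      (*-congˡ (⊛-cong (λ i → *-congʳ (G≋returning₀ i)) G≋returning₀ j))

corollary2p8 : ∀ {c ℓ} (R : Ring c ℓ) (A B C : Ring.Carrier R) →
  let open Ring R
      open PowerSeries R
      g = G A B C
  in ∀ n → (g ⊖ const 1# ⊖ const B ⊛ g ⊛ Z ⊖ const C ⊛ g ⊛ const A ⊛ g ⊛ Z ⊛ Z) n ≈ 0#
corollary2p8 R A B C n = x≈a+b+c⇒x-a-b-c≈0 (G-equation n)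
  where
  open RingLemmas R
  open Returning R A B C
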